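{- Let $h\ge1$ and let $G$ be a finite bipartite graph with bipartition $V_1,V_2$ that is $(c_1,c_2)$-biregular with $c_1\le c_2$, left-twin-free, and does not contain $K_{h+1}$ as a minor. Then $c_2\le \alpha_h\cdot\left(\binom{\alpha_h}{\lceil\alpha_h/2\rceil}+1\right)$.
   Context: Fix a constant $a\ge 1$ such that for every $h\ge 1$ every finite graph with no $K_{h+1}$-minor has average degree at most $a\cdot h\cdot\sqrt{\log h}$ (such a constant exists by Kostochka's theorem), and set $\alpha_h:=\lceil a\cdot h\cdot\sqrt{\log h}\rceil$. A bipartite graph with bipartition $V_1,V_2$ is $(c_1,c_2)$-biregular if every vertex of $V_1$ has degree $c_1$ and every vertex of $V_2$ has degree $c_2$. It is left-twin-free if no two distinct vertices of $V_1$ have the same neighborhood. -}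

module Defs where

open import Data.Nat using (ℕ; zero; suc; _+_; _*_; _≤_)
open import Data.Fin using (Fin; zero; suc)
open import Data.Bool using (Bool; true; false; if_then_else_)
open import Data.Product using (Σ; _×_; ∃)
open import Relation.Binary.PropositionalEquality using (_≡_; _≢_)
open import Relation.Nullary using (¬_)

record Graph : Set where
  field
    n      : ℕ
    adj    : Fin n → Fin n → Bool
    sym    : ∀ u v → adj u v ≡ adj v u
    irrefl : ∀ v → adj v v ≡ false
open Graph public

count : ∀ {m} → (Fin m → Bool) → ℕ
count {zero}  f = 0
count {suc m} f = (if f zero then 1 else 0) + count (λ i → f (suc i))

sumFin : ∀ {m} → (Fin m → ℕ) → ℕ
sumFin {zero}  f = 0
sumFin {suc m} f = f zero + sumFin (λ i → f (suc i))

degree : (G : Graph) → Fin (n G) → ℕ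
degree G v = count (adj G v)

degreeSum : Graph → ℕ
degreeSum G = sumFin (degree G)

AvgDegreeAtMost : Graph → ℕ → Set
AvgDegreeAtMost G d = degreeSum G ≤ d * n G

data WalkIn (G : Graph) (S : Fin (n G) → Bool) : Fin (n G) → Fin (n G) → Set where
  here : ∀ {u} → S u ≡ true → WalkIn G S u u
  step : ∀ {u w v} → S u ≡ true → adj G u w ≡ true → WalkIn G S w v → WalkIn G S u v

ConnectedSet : (G : Graph) → (Fin (n G) → Bool) → Set
ConnectedSet G S = ∀ u v → S u ≡ true → S v ≡ true → WalkIn G S u v

HasCliqueMinor : Graph → ℕ → Set
HasCliqueMinor G k =
  Σ (Fin k → Fin (n G) → Bool) λ B →
    (∀ i → ∃ λ v → B i v ≡ true) ×
    (∀ i → ConnectedSet G (B i)) ×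
    (∀ i j v → i ≢ j → B i v ≡ true → B j v ≡ false) ×
    (∀ i j → i ≢ j → ∃ λ u → ∃ λ v → B i u ≡ true × B j v ≡ true × adj G u v ≡ true)

KostochkaBound : (ℕ → ℕ) → Set
KostochkaBound α = ∀ h → 1 ≤ h → ∀ (G : Graph) → ¬ HasCliqueMinor G (suc h) → AvgDegreeAtMost G (α h)

-- bipartition: side v ≡ true means v ∈ V₁, false means v ∈ V₂;
-- every edge joins V₁ and V₂.
IsBipartition : (G : Graph) → (Fin (n G) → Bool) → Set
IsBipartition G side = ∀ u v → adj G u v ≡ true → side u ≢ side v

IsBiregular : (G : Graph) → (Fin (n G) → Bool) → ℕ → ℕ → Set
IsBiregular G side c₁ c₂ =
  (∀ v → side v ≡ true → degree G v ≡ c₁) ×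
  (∀ v → side v ≡ false → degree G v ≡ c₂)

LeftTwinFree : (G : Graph) → (Fin (n G) → Bool) → Set
LeftTwinFree G side = ∀ u v → side u ≡ true → side v ≡ true → u ≢ v →
  ¬ (∀ w → adj G u w ≡ adj G v w)

SideAssignment : Graph → Set
SideAssignment G = Fin (n G) → Bool

module Submission where

-- Suppose c₂ > d q with d = α h and q = C(d, ⌈d/2⌉) + 1. Every degree of G is at least c₁, so
-- Kostochka's bound gives c₁ ≤ d; double counting then yields Hall's condition |N(A)| ≥ q |A| for
-- every A ⊆ V₂. By Hall's theorem (delete edges while the condition survives, using submodularity of
-- |N|) every a ∈ V₂ receives a star of at least q private neighbours in V₁. Contracting the stars gives
-- a K_{h+1}-minor-free graph on V₂, which by Kostochka has a vertex a of degree at most d. The other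
-- c₁ - 1 neighbours of each leaf of the star of a are neighbours of a in the contracted graph, and by
-- twin-freeness distinct leaves give distinct (c₁ - 1)-subsets. Hence q ≤ C(d, c₁ - 1) ≤ C(d, ⌈d/2⌉),
-- a contradiction.

open import Defs renaming (sym to adj-sym)

open import Data.Bool using (Bool; true; false; if_then_else_; _∧_; _∨_; not)
import Data.Bool as Bool
open import Data.Bool.Properties using (∧-identityʳ; ∧-zeroʳ; ∨-zeroʳ; ∨-comm; not-involutive; ¬-not)
open import Data.Fin using (Fin; zero; suc)
import Data.Fin.Properties as Fin
open import Data.Fin.Properties using (_≟_; any?)
open import Data.Fin.Subset.Properties using (anySubset?)
open import Data.Nat using (ℕ; zero; suc; pred; _+_; _*_; _∸_; _≤_; _<_; _≤′_; ≤′-refl; ≤′-step;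
  z≤n; s≤s; ⌈_/2⌉; ⌊_/2⌋; _≤?_; >-nonZero; >-nonZero⁻¹)
open import Data.Nat.Combinatorics using (_C_; nC1≡n; nCk≡nC[n∸k]; k>n⇒nCk≡0; nCk+nC[k+1]≡[n+1]C[k+1])
open import Data.Nat.Induction using (<-wellFounded)
open import Data.Nat.Properties hiding (_≟_)
open import Data.Product using (Σ; ∃; _×_; _,_; proj₁; proj₂)
open import Data.Sum using (_⊎_; inj₁; inj₂)
open import Data.Vec using (lookup; tabulate)
open import Data.Vec.Properties using (lookup∘tabulate)
open import Function using (_∘_; case_of_)
open import Induction.WellFounded using (Acc; acc)
open import Relation.Binary.PropositionalEquality
open import Relation.Nullary using (yes; no; does; ¬_; contradiction)
open import Relation.Nullary.Decidable using (dec-true; dec-false; decidable-stable; toSum; ¬?; _×-dec_)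

open import Algebra.Properties.Semiring.Sum +-*-semiring
  using (sum; sum-cong-≗; ∑-distrib-+; ∑-comm; *-distribʳ-sum)

private
  variable
    m k l : ℕ

-- Booleans and finite counting

∧-intro : ∀ {a b} → a ≡ true → b ≡ true → a ∧ b ≡ true
∧-intro = cong₂ _∧_

∧-elim : ∀ {a b} → a ∧ b ≡ true → a ≡ true × b ≡ true
∧-elim {true} {true} _ = refl , refl

∨-elim : ∀ {a b} → a ∨ b ≡ true → a ≡ true ⊎ b ≡ true
∨-elim {true}  _ = inj₁ refl
∨-elim {false} e = inj₂ e

_==_ : Fin m → Fin m → Bool
i == j = does (i ≟ j)

==-refl : (i : Fin m) → (i == i) ≡ true
==-refl i = dec-true (i ≟ i) refl

==-≢ : {i j : Fin m} → i ≢ j → (i == j) ≡ false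
==-≢ {i = i} {j} = dec-false (i ≟ j)

==⇒≡ : {i j : Fin m} → (i == j) ≡ true → i ≡ j
==⇒≡ {i = i} {j} e with i ≟ j
... | yes i≡j = i≡j

==-sym : (i j : Fin m) → (i == j) ≡ (j == i)
==-sym i j with toSum (i ≟ j)
... | inj₁ refl = refl
... | inj₂ i≢j  = trans (==-≢ i≢j) (sym (==-≢ (i≢j ∘ sym)))

any : (Fin m → Bool) → Bool
any {zero}  f = false
any {suc m} f = f zero ∨ any (f ∘ suc)

any⁺ : (f : Fin m → Bool) (i : Fin m) → f i ≡ true → any f ≡ true
any⁺ f zero    fi = cong (_∨ any (f ∘ suc)) fi
any⁺ f (suc i) fi with f zero
... | true  = refl
... | false = any⁺ (f ∘ suc) i fi

any⁻ : (f : Fin m → Bool) → any f ≡ true → ∃ λ i → f i ≡ true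
any⁻ {suc m} f e with f zero in f0
... | true  = zero , f0
... | false = let i , fi = any⁻ (f ∘ suc) e in suc i , fi

any-cong : {f g : Fin m → Bool} → (∀ i → f i ≡ g i) → any f ≡ any g
any-cong {zero}  f≗g = refl
any-cong {suc m} f≗g = cong₂ _∨_ (f≗g zero) (any-cong (f≗g ∘ suc))

iverson : Bool → ℕ
iverson b = if b then 1 else 0

sumFin≡sum : (f : Fin m → ℕ) → sumFin f ≡ sum f
sumFin≡sum {zero}  f = refl
sumFin≡sum {suc m} f = cong (f zero +_) (sumFin≡sum (f ∘ suc))

count≡sum : (P : Fin m → Bool) → count P ≡ sum (iverson ∘ P)
count≡sum {zero}  P = refl
count≡sum {suc m} P = cong (iverson (P zero) +_) (count≡sum (P ∘ suc))

sum-const : ∀ m c → sum {m} (λ _ → c) ≡ m * c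
sum-const zero    c = refl
sum-const (suc m) c = cong (c +_) (sum-const m c)

sum-mono-≤ : {f g : Fin m → ℕ} → (∀ i → f i ≤ g i) → sum f ≤ sum g
sum-mono-≤ {zero}  f≤g = z≤n
sum-mono-≤ {suc m} f≤g = +-mono-≤ (f≤g zero) (sum-mono-≤ (f≤g ∘ suc))

sum-mono-< : {f g : Fin m → ℕ} (i : Fin m) → (∀ j → f j ≤ g j) → f i < g i → sum f < sum g
sum-mono-< zero    f≤g fi<gi = +-mono-<-≤ fi<gi (sum-mono-≤ (f≤g ∘ suc))
sum-mono-< (suc i) f≤g fi<gi = +-mono-≤-< (f≤g zero) (sum-mono-< i (f≤g ∘ suc) fi<gi)

term≤sum : (f : Fin m → ℕ) (i : Fin m) → f i ≤ sum f
term≤sum f zero    = m≤m+n _ _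
term≤sum f (suc i) = ≤-trans (term≤sum (f ∘ suc) i) (m≤n+m _ _)

_⊆_ : (Fin m → Bool) → (Fin m → Bool) → Set
P ⊆ Q = ∀ i → P i ≡ true → Q i ≡ true

_∪_ _∩_ : (Fin m → Bool) → (Fin m → Bool) → Fin m → Bool
(P ∪ Q) i = P i ∨ Q i
(P ∩ Q) i = P i ∧ Q i

iverson-mono : ∀ {a b} → (a ≡ true → b ≡ true) → iverson a ≤ iverson b
iverson-mono {false} a⇒b = z≤n
iverson-mono {true}  a⇒b rewrite a⇒b refl = ≤-refl

iverson≤1 : ∀ b → iverson b ≤ 1
iverson≤1 true  = ≤-refl
iverson≤1 false = z≤n

count-cong : {P Q : Fin m → Bool} → (∀ i → P i ≡ Q i) → count P ≡ count Q
count-cong {P = P} {Q} P≗Q = begin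
  count P             ≡⟨ count≡sum P ⟩
  sum (iverson ∘ P)   ≡⟨ sum-cong-≗ (cong iverson ∘ P≗Q) ⟩
  sum (iverson ∘ Q)   ≡⟨ count≡sum Q ⟨
  count Q             ∎
  where open ≡-Reasoning

count-mono : {P Q : Fin m → Bool} → P ⊆ Q → count P ≤ count Q
count-mono {P = P} {Q} P⊆Q = begin
  count P             ≡⟨ count≡sum P ⟩
  sum (iverson ∘ P)   ≤⟨ sum-mono-≤ (λ i → iverson-mono (P⊆Q i)) ⟩
  sum (iverson ∘ Q)   ≡⟨ count≡sum Q ⟨
  count Q             ∎
  where open ≤-Reasoning

count-none : (P : Fin m → Bool) → (∀ i → P i ≢ true) → count P ≡ 0
count-none {zero}  P none = refl
count-none {suc m} P none with P zero in P0
... | true  = contradiction P0 (none zero)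
... | false = count-none (P ∘ suc) (none ∘ suc)

member⇒1≤count : (P : Fin m → Bool) (i : Fin m) → P i ≡ true → 1 ≤ count P
member⇒1≤count P i Pi = begin
  1                   ≡⟨ cong iverson Pi ⟨
  iverson (P i)       ≤⟨ term≤sum (iverson ∘ P) i ⟩
  sum (iverson ∘ P)   ≡⟨ count≡sum P ⟨
  count P             ∎
  where open ≤-Reasoning

1≤count⇒member : (P : Fin m → Bool) → 1 ≤ count P → ∃ λ i → P i ≡ true
1≤count⇒member {suc m} P 1≤count with P zero in P0
... | true  = zero , P0
... | false = let i , Pi = 1≤count⇒member (P ∘ suc) 1≤count in suc i , Pi

count≤1 : (P : Fin m → Bool) → (∀ i j → P i ≡ true → P j ≡ true → i ≡ j) → count P ≤ 1
count≤1 {zero}  P unique = z≤n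
count≤1 {suc m} P unique with P zero in P0
... | true  = ≤-reflexive (cong suc (count-none (P ∘ suc) λ i Pi → case unique zero (suc i) P0 Pi of λ ()))
... | false = count≤1 (P ∘ suc) (λ i j Pi Pj → Fin.suc-injective (unique (suc i) (suc j) Pi Pj))

count+count≡sum : (P Q : Fin m → Bool) →
  count P + count Q ≡ sum (λ i → iverson (P i) + iverson (Q i))
count+count≡sum P Q = begin
  count P + count Q                           ≡⟨ cong₂ _+_ (count≡sum P) (count≡sum Q) ⟩
  sum (iverson ∘ P) + sum (iverson ∘ Q)       ≡⟨ ∑-distrib-+ (iverson ∘ P) (iverson ∘ Q) ⟨
  sum (λ i → iverson (P i) + iverson (Q i))   ∎
  where open ≡-Reasoning

iverson-∨-∧ : ∀ a b → iverson (a ∨ b) + iverson (a ∧ b) ≡ iverson a + iverson b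
iverson-∨-∧ true  true  = refl
iverson-∨-∧ true  false = refl
iverson-∨-∧ false true  = refl
iverson-∨-∧ false false = refl

count-∪-∩ : (P Q : Fin m → Bool) → count (P ∪ Q) + count (P ∩ Q) ≡ count P + count Q
count-∪-∩ P Q = begin
  count (P ∪ Q) + count (P ∩ Q)                                ≡⟨ count+count≡sum (P ∪ Q) (P ∩ Q) ⟩
  sum (λ i → iverson (P i ∨ Q i) + iverson (P i ∧ Q i))        ≡⟨ sum-cong-≗ (λ i → iverson-∨-∧ (P i) (Q i)) ⟩
  sum (λ i → iverson (P i) + iverson (Q i))                    ≡⟨ count+count≡sum P Q ⟨
  count P + count Q                                            ∎
  where open ≡-Reasoning

count-split : (P Q : Fin m → Bool) →
  count P ≡ count (λ i → P i ∧ Q i) + count (λ i → P i ∧ not (Q i))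
count-split P Q = begin
  count P                                                      ≡⟨ count≡sum P ⟩
  sum (iverson ∘ P)                                            ≡⟨ sum-cong-≗ (λ i → pointwise (P i) (Q i)) ⟩
  sum (λ i → iverson (P i ∧ Q i) + iverson (P i ∧ not (Q i)))  ≡⟨ count+count≡sum (λ i → P i ∧ Q i) (λ i → P i ∧ not (Q i)) ⟨
  count (λ i → P i ∧ Q i) + count (λ i → P i ∧ not (Q i))      ∎
  where
  open ≡-Reasoning
  pointwise : ∀ a b → iverson a ≡ iverson (a ∧ b) + iverson (a ∧ not b)
  pointwise true  true  = refl
  pointwise true  false = refl
  pointwise false b     = refl

count-== : (i : Fin m) → count (_== i) ≡ 1
count-== {suc m} zero    = cong suc (count-none {m} (λ j → suc j == zero) (λ _ ()))
count-== {suc m} (suc i) = count-== i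

count-remove : (P : Fin m → Bool) (i : Fin m) → P i ≡ true →
  count P ≡ suc (count (λ j → P j ∧ not (j == i)))
count-remove P i Pi = begin
  count P                                                       ≡⟨ count-split P (_== i) ⟩
  count (λ j → P j ∧ (j == i)) + count (λ j → P j ∧ not (j == i)) ≡⟨ cong (_+ count (λ j → P j ∧ not (j == i))) (trans (count-cong only-i) (count-== i)) ⟩
  suc (count (λ j → P j ∧ not (j == i)))                        ∎
  where
  open ≡-Reasoning
  only-i : ∀ j → P j ∧ (j == i) ≡ (j == i)
  only-i j with j == i in j==i
  ... | true  = trans (∧-identityʳ (P j)) (subst (λ x → P x ≡ true) (sym (==⇒≡ j==i)) Pi)
  ... | false = ∧-zeroʳ (P j)

count-∧ˡ : (b : Bool) (P : Fin m → Bool) → count (λ i → b ∧ P i) ≡ iverson b * count P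
count-∧ˡ true  P = sym (+-identityʳ (count P))
count-∧ˡ false P = count-none (λ i → false ∧ P i) (λ _ ())

count-comm : (R : Fin m → Fin l → Bool) → sum (λ i → count (R i)) ≡ sum (λ j → count (λ i → R i j))
count-comm R = begin
  sum (λ i → count (R i))                      ≡⟨ sum-cong-≗ (λ i → count≡sum (R i)) ⟩
  sum (λ i → sum (λ j → iverson (R i j)))      ≡⟨ ∑-comm (λ i j → iverson (R i j)) ⟩
  sum (λ j → sum (λ i → iverson (R i j)))      ≡⟨ sum-cong-≗ (λ j → count≡sum (λ i → R i j)) ⟨
  sum (λ j → count (λ i → R i j))              ∎
  where open ≡-Reasoning

enum : (P : Fin m → Bool) → Fin (count P) → Fin m
enum {suc m} P with P zero
... | true  = λ { zero → zero ; (suc i) → suc (enum (P ∘ suc) i) }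
... | false = suc ∘ enum (P ∘ suc)

enum-member : (P : Fin m → Bool) (i : Fin (count P)) → P (enum P i) ≡ true
enum-member {suc m} P i with P zero in P0
enum-member {suc m} P zero    | true  = P0
enum-member {suc m} P (suc i) | true  = enum-member (P ∘ suc) i
enum-member {suc m} P i       | false = enum-member (P ∘ suc) i

enum-injective : (P : Fin m → Bool) {i j : Fin (count P)} → enum P i ≡ enum P j → i ≡ j
enum-injective {suc m} P {i} {j} e with P zero
enum-injective {suc m} P {zero}  {zero}  e | true = refl
enum-injective {suc m} P {suc i} {suc j} e | true =
  cong suc (enum-injective (P ∘ suc) (Fin.suc-injective e))
enum-injective {suc m} P {i} {j} e | false = enum-injective (P ∘ suc) (Fin.suc-injective e)

enum-surjective : (P : Fin m → Bool) (v : Fin m) → P v ≡ true → ∃ λ i → enum P i ≡ v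
enum-surjective {suc m} P v Pv with P zero in P0
enum-surjective {suc m} P zero    Pv | true  = zero , refl
enum-surjective {suc m} P (suc v) Pv | true  =
  let i , e = enum-surjective (P ∘ suc) v Pv in suc i , cong suc e
enum-surjective {suc m} P (suc v) Pv | false =
  let i , e = enum-surjective (P ∘ suc) v Pv in i , cong suc e
enum-surjective {suc m} P zero    Pv | false = case trans (sym Pv) P0 of λ ()

count∘enum : (P Q : Fin m → Bool) → count (Q ∘ enum P) ≡ count (λ v → P v ∧ Q v)
count∘enum {zero}  P Q = refl
count∘enum {suc m} P Q with P zero
... | true  = cong (iverson (Q zero) +_) (count∘enum (P ∘ suc) (Q ∘ suc))
... | false = count∘enum (P ∘ suc) (Q ∘ suc)

-- Binomial coefficients

nCk≤[1+n]Ck : ∀ n k → n C k ≤ suc n C k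
nCk≤[1+n]Ck n zero    = ≤-refl
nCk≤[1+n]Ck n (suc k) = begin
  n C suc k               ≤⟨ m≤n+m (n C suc k) (n C k) ⟩
  n C k + n C suc k       ≡⟨ nCk+nC[k+1]≡[n+1]C[k+1] n k ⟩
  suc n C suc k           ∎
  where open ≤-Reasoning

nCk-monoˡ : ∀ k {m n} → m ≤ n → m C k ≤ n C k
nCk-monoˡ k = go ∘ ≤⇒≤′
  where
  go : ∀ {m n} → m ≤′ n → m C k ≤ n C k
  go ≤′-refl            = ≤-refl
  go (≤′-step {n} m≤′n) = ≤-trans (go m≤′n) (nCk≤[1+n]Ck n k)

nCk≤nC[1+k] : ∀ n k → k + k < n → n C k ≤ n C suc k
nCk≤nC[1+k] (suc n) zero    _ = subst (1 ≤_) (sym (nC1≡n (suc n))) (s≤s z≤n)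
nCk≤nC[1+k] (suc n) (suc k) (s≤s 2k+1<n) = begin
  suc n C suc k                    ≡⟨ nCk+nC[k+1]≡[n+1]C[k+1] n k ⟨
  n C k + n C suc k                ≤⟨ +-monoˡ-≤ (n C suc k) nCk≤nC[2+k] ⟩
  n C suc (suc k) + n C suc k      ≡⟨ +-comm (n C suc (suc k)) (n C suc k) ⟩
  n C suc k + n C suc (suc k)      ≡⟨ nCk+nC[k+1]≡[n+1]C[k+1] n (suc k) ⟩
  suc n C suc (suc k)              ∎
  where
  open ≤-Reasoning
  2k+2≤n : suc (suc (k + k)) ≤ n
  2k+2≤n = subst (_≤ n) (cong suc (+-suc k k)) 2k+1<n
  nCk≤nC[2+k] : n C k ≤ n C suc (suc k)
  nCk≤nC[2+k] with m≤n⇒m<n∨m≡n 2k+2≤n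
  ... | inj₁ 2k+2<n = ≤-trans (nCk≤nC[1+k] n k (≤-trans (n≤1+n _) (<⇒≤ 2k+2<n)))
                              (nCk≤nC[1+k] n (suc k) (subst (_< n) (sym (cong suc (+-suc k k))) 2k+2<n))
  ... | inj₂ refl   = ≤-reflexive (begin-equality
    n C k                    ≡⟨ nCk≡nC[n∸k] (≤-trans (m≤m+n k k) (≤-trans (n≤1+n _) (n≤1+n _))) ⟩
    n C (n ∸ k)              ≡⟨ cong (n C_) (m+n∸n≡m (suc (suc k)) k) ⟩
    n C suc (suc k)          ∎)

nCj≤nCk : ∀ n {j k} → j ≤′ k → k + k ≤ suc n → n C j ≤ n C k
nCj≤nCk n ≤′-refl                 _        = ≤-refl
nCj≤nCk n (≤′-step {k} j≤′k) 2k+2≤n+1 = ≤-trans (nCj≤nCk n j≤′k (≤-trans (+-mono-≤ (n≤1+n k) (n≤1+n k)) 2k+2≤n+1))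
  (nCk≤nC[1+k] n k (≤-pred (subst (_≤ suc n) (cong suc (+-suc k k)) 2k+2≤n+1)))

⌈n/2⌉+⌈n/2⌉≤1+n : ∀ n → ⌈ n /2⌉ + ⌈ n /2⌉ ≤ suc n
⌈n/2⌉+⌈n/2⌉≤1+n n = subst (⌈ n /2⌉ + ⌈ n /2⌉ ≤_) (⌊n/2⌋+⌈n/2⌉≡n (suc n))
  (+-monoʳ-≤ ⌈ n /2⌉ (⌈n/2⌉-mono (n≤1+n n)))

nCk≤nC⌈n/2⌉ : ∀ n k → n C k ≤ n C ⌈ n /2⌉
nCk≤nC⌈n/2⌉ n k with k ≤? ⌈ n /2⌉ | k ≤? n
... | yes k≤⌈n/2⌉ | _       = nCj≤nCk n (≤⇒≤′ k≤⌈n/2⌉) (⌈n/2⌉+⌈n/2⌉≤1+n n)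
... | no  k>⌈n/2⌉ | no  k>n = ≤-trans (≤-reflexive (k>n⇒nCk≡0 (≰⇒> k>n))) z≤n
... | no  k>⌈n/2⌉ | yes k≤n = begin
  n C k             ≡⟨ nCk≡nC[n∸k] k≤n ⟩
  n C (n ∸ k)       ≤⟨ nCj≤nCk n (≤⇒≤′ n∸k≤⌈n/2⌉) (⌈n/2⌉+⌈n/2⌉≤1+n n) ⟩
  n C ⌈ n /2⌉       ∎
  where
  open ≤-Reasoning
  n∸k≤⌈n/2⌉ : n ∸ k ≤ ⌈ n /2⌉
  n∸k≤⌈n/2⌉ = begin
    n ∸ k                        ≤⟨ ∸-monoʳ-≤ n (<⇒≤ (≰⇒> k>⌈n/2⌉)) ⟩
    n ∸ ⌈ n /2⌉                  ≡⟨ cong (_∸ ⌈ n /2⌉) (⌊n/2⌋+⌈n/2⌉≡n n) ⟨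
    ⌊ n /2⌋ + ⌈ n /2⌉ ∸ ⌈ n /2⌉   ≡⟨ m+n∸n≡m ⌊ n /2⌋ ⌈ n /2⌉ ⟩
    ⌊ n /2⌋                      ≤⟨ ⌊n/2⌋≤⌈n/2⌉ n ⟩
    ⌈ n /2⌉                      ∎

-- Induction on the ground set: split the family according to whether its sets contain the first
-- point, bound both parts by the induction hypothesis and add them up with Pascal's rule.
count-family≤nCk : (T : Fin m → Bool) (r : ℕ) (P : Fin k → Bool) (X : Fin k → Fin m → Bool) →
  (∀ u → P u ≡ true → X u ⊆ T) →
  (∀ u → P u ≡ true → count (X u) ≡ r) →
  (∀ u v → P u ≡ true → P v ≡ true → (∀ i → X u i ≡ X v i) → u ≡ v) →
  count P ≤ count T C r
count-family≤nCk {zero} T zero P X _ _ injective =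
  count≤1 P (λ u v Pu Pv → injective u v Pu Pv (λ ()))
count-family≤nCk {zero} T (suc r) P X _ size _ =
  ≤-reflexive (count-none P (λ u Pu → case size u Pu of λ ()))
count-family≤nCk {suc m} T r P X X⊆T size injective = begin
  count P                     ≡⟨ count-split P (λ u → X u zero) ⟩
  count P₁ + count P₀         ≤⟨ bound (T zero) r refl refl ⟩
  count T C r                 ∎
  where
  open ≤-Reasoning
  P₁ P₀ : Fin _ → Bool
  P₁ u = P u ∧ X u zero
  P₀ u = P u ∧ not (X u zero)

  restrict : (Q : Fin _ → Bool) (b : Bool) (r′ : ℕ) → iverson b + r′ ≡ r →
    (∀ u → Q u ≡ true → P u ≡ true × X u zero ≡ b) → count Q ≤ count (T ∘ suc) C r′
  restrict Q b r′ b+r′≡r split = count-family≤nCk (T ∘ suc) r′ Q (λ u → X u ∘ suc)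
    (λ u Qu i → X⊆T u (proj₁ (split u Qu)) (suc i))
    (λ u Qu → let Pu , Xu0 = split u Qu in
      +-cancelˡ-≡ (iverson b) _ _ (trans (cong (λ c → iverson c + _) (sym Xu0)) (trans (size u Pu) (sym b+r′≡r))))
    (λ u v Qu Qv tails → let Pu , Xu0 = split u Qu ; Pv , Xv0 = split v Qv in
      injective u v Pu Pv λ { zero → trans Xu0 (sym Xv0) ; (suc i) → tails i })

  split₁ : ∀ u → P₁ u ≡ true → P u ≡ true × X u zero ≡ true
  split₁ u = ∧-elim
  split₀ : ∀ u → P₀ u ≡ true → P u ≡ true × X u zero ≡ false
  split₀ u P₀u = let Pu , ¬Xu0 = ∧-elim P₀u in Pu , trans (sym (not-involutive _)) (cong not ¬Xu0)

  P₁-empty : (T zero ≡ false ⊎ r ≡ 0) → count P₁ ≡ 0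
  P₁-empty cases = count-none P₁ λ u P₁u → let Pu , Xu0 = split₁ u P₁u in case cases of λ
    { (inj₁ T0) → case trans (sym (X⊆T u Pu zero Xu0)) T0 of λ ()
    ; (inj₂ refl) → case trans (sym (size u Pu)) (cong (λ c → iverson c + count (X u ∘ suc)) Xu0) of λ () }

  bound : (t : Bool) (r′ : ℕ) → T zero ≡ t → r′ ≡ r → count P₁ + count P₀ ≤ count T C r
  bound false _ T0 _ rewrite T0 | P₁-empty (inj₁ T0) = restrict P₀ false r refl split₀
  bound true zero T0 refl rewrite P₁-empty (inj₂ refl) = restrict P₀ false 0 refl split₀
  bound true (suc r′) T0 refl rewrite T0 = begin
    count P₁ + count P₀                                   ≤⟨ +-mono-≤ (restrict P₁ true r′ refl split₁) (restrict P₀ false (suc r′) refl split₀) ⟩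
    count (T ∘ suc) C r′ + count (T ∘ suc) C suc r′       ≡⟨ nCk+nC[k+1]≡[n+1]C[k+1] (count (T ∘ suc)) r′ ⟩
    suc (count (T ∘ suc)) C suc r′                        ∎

-- Hall's theorem for stars of size q

BRel : ℕ → ℕ → Set
BRel l k = Fin l → Fin k → Bool

_⊆ᵣ_ : BRel l k → BRel l k → Set
F ⊆ᵣ E = ∀ x y → F x y ≡ true → E x y ≡ true

neighbours : BRel l k → (Fin k → Bool) → Fin l → Bool
neighbours E A x = any (λ y → A y ∧ E x y)

HallAt : ℕ → BRel l k → (Fin k → Bool) → Set
HallAt q E A = q * count A ≤ count (neighbours E A)

Hall : ℕ → BRel l k → Set
Hall q E = ∀ A → HallAt q E A

Functional : BRel l k → Set
Functional E = ∀ x y y′ → E x y ≡ true → E x y′ ≡ true → y ≡ y′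

_∖⟨_,_⟩ : BRel l k → Fin l → Fin k → BRel l k
(E ∖⟨ x₀ , y₀ ⟩) x y = E x y ∧ not ((x == x₀) ∧ (y == y₀))

edges : BRel l k → ℕ
edges E = sum (λ x → count (E x))

neighbour⁺ : (E : BRel l k) (A : Fin k → Bool) {x : Fin l} (y : Fin k) →
  A y ≡ true → E x y ≡ true → neighbours E A x ≡ true
neighbour⁺ E A {x} y Ay Exy = any⁺ (λ y → A y ∧ E x y) y (∧-intro Ay Exy)

neighbour⁻ : (E : BRel l k) (A : Fin k → Bool) {x : Fin l} →
  neighbours E A x ≡ true → ∃ λ y → A y ≡ true × E x y ≡ true
neighbour⁻ E A {x} Nx = let y , AyExy = any⁻ (λ y → A y ∧ E x y) Nx in y , ∧-elim AyExy

neighbours-∪ : (E : BRel l k) (A B : Fin k → Bool) → neighbours E (A ∪ B) ⊆ (neighbours E A ∪ neighbours E B)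
neighbours-∪ E A B x Nx with neighbour⁻ E (A ∪ B) Nx
... | y , AyBy , Exy with ∨-elim AyBy
... | inj₁ Ay = cong (_∨ neighbours E B x) (neighbour⁺ E A y Ay Exy)
... | inj₂ By = trans (cong (neighbours E A x ∨_) (neighbour⁺ E B y By Exy)) (∨-zeroʳ _)

neighbours-∩ : (E : BRel l k) (A B : Fin k → Bool) → neighbours E (A ∩ B) ⊆ (neighbours E A ∩ neighbours E B)
neighbours-∩ E A B x Nx = let y , AyBy , Exy = neighbour⁻ E (A ∩ B) Nx ; Ay , By = ∧-elim AyBy in
  ∧-intro (neighbour⁺ E A y Ay Exy) (neighbour⁺ E B y By Exy)

neighbours-== : (E : BRel l k) (y₀ : Fin k) (x : Fin l) → neighbours E (_== y₀) x ≡ E x y₀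
neighbours-== E y₀ x with E x y₀ in Exy₀
... | true  = neighbour⁺ E (_== y₀) y₀ (==-refl y₀) Exy₀
... | false = ¬-not λ N → let y , y==y₀ , Exy = neighbour⁻ E (_== y₀) N in
  case trans (sym Exy) (trans (cong (E x) (==⇒≡ y==y₀)) Exy₀) of λ ()

HallAt-cong : (q : ℕ) (E : BRel l k) {A A′ : Fin k → Bool} → (∀ y → A y ≡ A′ y) → HallAt q E A → HallAt q E A′
HallAt-cong q E A≗A′ =
  subst₂ (λ a b → q * a ≤ b) (count-cong A≗A′) (count-cong (λ x → any-cong (λ y → cong (_∧ E x y) (A≗A′ y))))

hall? : (q : ℕ) (E : BRel l k) → Hall q E ⊎ ∃ λ A → ¬ HallAt q E A
hall? q E with anySubset? (λ S → ¬? (q * count (lookup S) ≤? count (neighbours E (lookup S))))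
... | yes (S , violated) = inj₂ (lookup S , violated)
... | no  none           = inj₁ λ A → HallAt-cong q E (lookup∘tabulate A)
  (decidable-stable (_ ≤? _) (λ violated → none (tabulate A , violated)))

∖-⊆ : (E : BRel l k) (x₀ : Fin l) (y₀ : Fin k) → (E ∖⟨ x₀ , y₀ ⟩) ⊆ᵣ E
∖-⊆ E x₀ y₀ x y = proj₁ ∘ ∧-elim

∖-≢ˡ : (E : BRel l k) {x₀ x : Fin l} (y₀ y : Fin k) → x ≢ x₀ → (E ∖⟨ x₀ , y₀ ⟩) x y ≡ E x y
∖-≢ˡ E y₀ y x≢x₀ rewrite ==-≢ x≢x₀ = ∧-identityʳ _

∖-≢ʳ : (E : BRel l k) (x₀ x : Fin l) {y₀ y : Fin k} → y ≢ y₀ → (E ∖⟨ x₀ , y₀ ⟩) x y ≡ E x y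
∖-≢ʳ E x₀ x y≢y₀ rewrite ==-≢ y≢y₀ | ∧-zeroʳ (x == x₀) = ∧-identityʳ _

edges-∖ : (E : BRel l k) {x₀ : Fin l} {y₀ : Fin k} → E x₀ y₀ ≡ true → edges (E ∖⟨ x₀ , y₀ ⟩) < edges E
edges-∖ E {x₀} {y₀} Ex₀y₀ = sum-mono-< x₀ (λ x → count-mono (∖-⊆ E x₀ y₀ x)) (begin-strict
  count ((E ∖⟨ x₀ , y₀ ⟩) x₀)                    ≡⟨ count-cong (λ y → cong (λ b → E x₀ y ∧ not (b ∧ (y == y₀))) (==-refl x₀)) ⟩
  count (λ y → E x₀ y ∧ not (y == y₀))          <⟨ n<1+n _ ⟩
  suc (count (λ y → E x₀ y ∧ not (y == y₀)))    ≡⟨ count-remove (E x₀) y₀ Ex₀y₀ ⟨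
  count (E x₀)                                  ∎)
  where open ≤-Reasoning

∖-violation⇒unique-neighbour : (q : ℕ) (E : BRel l k) (x₀ : Fin l) (y₀ : Fin k) (A : Fin k → Bool) → Hall q E →
  ¬ HallAt q (E ∖⟨ x₀ , y₀ ⟩) A → ∀ y → A y ≡ true → E x₀ y ≡ true → y ≡ y₀
∖-violation⇒unique-neighbour q E x₀ y₀ A hallE violated y Ay Ex₀y =
  decidable-stable (y ≟ y₀) λ y≢y₀ → violated (subst (q * count A ≤_) (count-cong (agree y≢y₀)) (hallE A))
  where
  agree : y ≢ y₀ → ∀ x → neighbours E A x ≡ neighbours (E ∖⟨ x₀ , y₀ ⟩) A x
  agree y≢y₀ x with toSum (x ≟ x₀)
  ... | inj₂ x≢x₀ = any-cong (λ y′ → cong (A y′ ∧_) (sym (∖-≢ˡ E y₀ y′ x≢x₀)))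
  ... | inj₁ refl = trans (neighbour⁺ E A y Ay Ex₀y)
    (sym (neighbour⁺ (E ∖⟨ x₀ , y₀ ⟩) A y Ay (trans (∖-≢ʳ E x₀ x₀ y≢y₀) Ex₀y)))

-- Away from x₀ this is the submodularity of neighbourhoods; at x₀ only N(A ∪ B) can contribute.
count-neighbours-∪∩-∖ : (E : BRel l k) (x₀ : Fin l) (y₁ y₂ : Fin k) (A B : Fin k → Bool) →
  neighbours E (A ∩ B) x₀ ≢ true →
  count (neighbours E (A ∪ B)) + count (neighbours E (A ∩ B))
    ≤ (count (neighbours (E ∖⟨ x₀ , y₁ ⟩) A) + count (neighbours (E ∖⟨ x₀ , y₂ ⟩) B)) + 1
count-neighbours-∪∩-∖ E x₀ y₁ y₂ A B x₀∉N[A∩B] = begin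
  count (N (A ∪ B)) + count (N (A ∩ B))
    ≡⟨ count+count≡sum (N (A ∪ B)) (N (A ∩ B)) ⟩
  sum (λ x → iverson (N (A ∪ B) x) + iverson (N (A ∩ B) x))
    ≤⟨ sum-mono-≤ pointwise ⟩
  sum (λ x → (iverson (N₁A x) + iverson (N₂B x)) + iverson (x == x₀))
    ≡⟨ ∑-distrib-+ (λ x → iverson (N₁A x) + iverson (N₂B x)) (iverson ∘ (_== x₀)) ⟩
  sum (λ x → iverson (N₁A x) + iverson (N₂B x)) + sum (iverson ∘ (_== x₀))
    ≡⟨ cong₂ _+_ (count+count≡sum N₁A N₂B) (count≡sum (_== x₀)) ⟨
  (count N₁A + count N₂B) + count (_== x₀)
    ≡⟨ cong ((count N₁A + count N₂B) +_) (count-== x₀) ⟩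
  (count N₁A + count N₂B) + 1 ∎
  where
  open ≤-Reasoning
  N : (Fin _ → Bool) → Fin _ → Bool
  N = neighbours E
  N₁A N₂B : Fin _ → Bool
  N₁A = neighbours (E ∖⟨ x₀ , y₁ ⟩) A
  N₂B = neighbours (E ∖⟨ x₀ , y₂ ⟩) B

  pointwise : ∀ x → iverson (N (A ∪ B) x) + iverson (N (A ∩ B) x) ≤ (iverson (N₁A x) + iverson (N₂B x)) + iverson (x == x₀)
  pointwise x with toSum (x ≟ x₀)
  ... | inj₁ refl = begin
    iverson (N (A ∪ B) x₀) + iverson (N (A ∩ B) x₀)  ≡⟨ cong (λ b → iverson (N (A ∪ B) x₀) + iverson b) (¬-not x₀∉N[A∩B]) ⟩
    iverson (N (A ∪ B) x₀) + 0                       ≤⟨ +-monoˡ-≤ 0 (iverson≤1 _) ⟩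
    1                                                ≤⟨ m≤n+m 1 _ ⟩
    (iverson (N₁A x₀) + iverson (N₂B x₀)) + 1        ≡⟨ cong (λ b → (iverson (N₁A x₀) + iverson (N₂B x₀)) + iverson b) (==-refl x₀) ⟨
    (iverson (N₁A x₀) + iverson (N₂B x₀)) + iverson (x₀ == x₀) ∎
  ... | inj₂ x≢x₀ = begin
    iverson (N (A ∪ B) x) + iverson (N (A ∩ B) x)
      ≤⟨ +-mono-≤ (iverson-mono (neighbours-∪ E A B x)) (iverson-mono (neighbours-∩ E A B x)) ⟩
    iverson (N A x ∨ N B x) + iverson (N A x ∧ N B x)
      ≡⟨ iverson-∨-∧ (N A x) (N B x) ⟩
    iverson (N A x) + iverson (N B x)
      ≡⟨ cong₂ (λ a b → iverson a + iverson b) (agree y₁ A) (agree y₂ B) ⟩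
    iverson (N₁A x) + iverson (N₂B x)
      ≤⟨ m≤m+n _ _ ⟩
    (iverson (N₁A x) + iverson (N₂B x)) + iverson (x == x₀) ∎
    where
    agree : ∀ y₀ D → N D x ≡ neighbours (E ∖⟨ x₀ , y₀ ⟩) D x
    agree y₀ D = any-cong (λ y → cong (D y ∧_) (sym (∖-≢ˡ E y₀ y x≢x₀)))

-- The exchange step of Hall's theorem: if both deletions violated Hall's condition, at sets A and B,
-- then x₀ ∉ N(A ∩ B) and the bound above contradicts Hall's condition for A ∪ B and A ∩ B.
hall-∖⊎hall-∖ : (q : ℕ) (E : BRel l k) (x₀ : Fin l) {y₁ y₂ : Fin k} → Hall q E → y₁ ≢ y₂ →
  Hall q (E ∖⟨ x₀ , y₁ ⟩) ⊎ Hall q (E ∖⟨ x₀ , y₂ ⟩)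
hall-∖⊎hall-∖ q E x₀ {y₁} {y₂} hallE y₁≢y₂ with hall? q (E ∖⟨ x₀ , y₁ ⟩) | hall? q (E ∖⟨ x₀ , y₂ ⟩)
... | inj₁ hall₁ | _         = inj₁ hall₁
... | inj₂ _     | inj₁ hall₂ = inj₂ hall₂
... | inj₂ (A , violatedA) | inj₂ (B , violatedB) = contradiction (begin
    q * count A + q * count B                                    ≡⟨ *-distribˡ-+ q (count A) (count B) ⟨
    q * (count A + count B)                                      ≡⟨ cong (q *_) (count-∪-∩ A B) ⟨
    q * (count (A ∪ B) + count (A ∩ B))                          ≡⟨ *-distribˡ-+ q (count (A ∪ B)) (count (A ∩ B)) ⟩
    q * count (A ∪ B) + q * count (A ∩ B)                        ≤⟨ +-mono-≤ (hallE (A ∪ B)) (hallE (A ∩ B)) ⟩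
    count (neighbours E (A ∪ B)) + count (neighbours E (A ∩ B))  ∎) (<⇒≱ (begin-strict
    count (neighbours E (A ∪ B)) + count (neighbours E (A ∩ B))  ≤⟨ count-neighbours-∪∩-∖ E x₀ y₁ y₂ A B x₀∉N[A∩B] ⟩
    (count N₁A + count N₂B) + 1                                  ≡⟨ +-comm (count N₁A + count N₂B) 1 ⟩
    suc (count N₁A + count N₂B)                                  <⟨ n<1+n _ ⟩
    suc (suc (count N₁A + count N₂B))                            ≡⟨ cong suc (+-suc (count N₁A) (count N₂B)) ⟨
    suc (count N₁A) + suc (count N₂B)                            ≤⟨ +-mono-≤ (≰⇒> violatedA) (≰⇒> violatedB) ⟩
    q * count A + q * count B                                    ∎))
  where
  open ≤-Reasoning
  N₁A N₂B : Fin _ → Bool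
  N₁A = neighbours (E ∖⟨ x₀ , y₁ ⟩) A
  N₂B = neighbours (E ∖⟨ x₀ , y₂ ⟩) B

  x₀∉N[A∩B] : neighbours E (A ∩ B) x₀ ≢ true
  x₀∉N[A∩B] N[A∩B]x₀ = let y , AyBy , Ex₀y = neighbour⁻ E (A ∩ B) N[A∩B]x₀ ; Ay , By = ∧-elim AyBy in
    y₁≢y₂ (trans (sym (∖-violation⇒unique-neighbour q E x₀ y₁ A hallE violatedA y Ay Ex₀y))
                 (∖-violation⇒unique-neighbour q E x₀ y₂ B hallE violatedB y By Ex₀y))

functional⊎branching : (E : BRel l k) →
  Functional E ⊎ ∃ λ x → ∃ λ y₁ → ∃ λ y₂ → E x y₁ ≡ true × E x y₂ ≡ true × y₁ ≢ y₂
functional⊎branching E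
  with any? (λ x → any? (λ y₁ → any? (λ y₂ → (E x y₁ Bool.≟ true) ×-dec (E x y₂ Bool.≟ true) ×-dec ¬? (y₁ ≟ y₂))))
... | yes (x , y₁ , y₂ , branching) = inj₂ (x , y₁ , y₂ , branching)
... | no  none = inj₁ λ x y₁ y₂ Exy₁ Exy₂ →
  decidable-stable (y₁ ≟ y₂) λ y₁≢y₂ → none (x , y₁ , y₂ , Exy₁ , Exy₂ , y₁≢y₂)

-- In a functional F satisfying Hall's condition, Hall at the singleton {y} says that y has at least q
-- private F-neighbours.
hall⇒functional-subrelation : (q : ℕ) (E : BRel l k) → Hall q E →
  ∃ λ F → F ⊆ᵣ E × Hall q F × Functional F
hall⇒functional-subrelation q E = shrink E (<-wellFounded (edges E))
  where
  weaken : ∀ {E E′ : BRel _ _} → E′ ⊆ᵣ E → (∃ λ F → F ⊆ᵣ E′ × Hall q F × Functional F) →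
    ∃ λ F → F ⊆ᵣ E × Hall q F × Functional F
  weaken E′⊆E (F , F⊆E′ , hallF , functionalF) = F , (λ x y → E′⊆E x y ∘ F⊆E′ x y) , hallF , functionalF

  shrink : ∀ E → Acc _<_ (edges E) → Hall q E → ∃ λ F → F ⊆ᵣ E × Hall q F × Functional F
  shrink E (acc smaller) hallE with functional⊎branching E
  ... | inj₁ functional = E , (λ _ _ Exy → Exy) , hallE , functional
  ... | inj₂ (x , y₁ , y₂ , Exy₁ , Exy₂ , y₁≢y₂) with hall-∖⊎hall-∖ q E x hallE y₁≢y₂
  ... | inj₁ hall₁ = weaken (∖-⊆ E x y₁) (shrink (E ∖⟨ x , y₁ ⟩) (smaller (edges-∖ E Exy₁)) hall₁)
  ... | inj₂ hall₂ = weaken (∖-⊆ E x y₂) (shrink (E ∖⟨ x , y₂ ⟩) (smaller (edges-∖ E Exy₂)) hall₂)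

-- Walks and star contractions

_++ʷ_ : ∀ {G S u v w} → WalkIn G S u v → WalkIn G S v w → WalkIn G S u w
here _        ++ʷ W′ = W′
step Su uv W  ++ʷ W′ = step Su uv (W ++ʷ W′)

walk-start : ∀ {G S u v} → WalkIn G S u v → S u ≡ true
walk-start (here Su)     = Su
walk-start (step Su _ _) = Su

inStar : (centre : Fin m → Fin l) (E : BRel l m) → Fin m → Fin l → Bool
inStar centre E a v = (v == centre a) ∨ E v a

-- A star is a centre together with its E-leaves. Of the contracted graph we only keep the edges
-- joining a leaf of one star to the centre of another.
module StarContraction (G : Graph) {m : ℕ} (centre : Fin m → Fin (n G)) (E : BRel (n G) m)
  (leaf-adjacent : ∀ u a → E u a ≡ true → adj G u (centre a) ≡ true)
  (stars-disjoint : ∀ v a b → inStar centre E a v ≡ true → inStar centre E b v ≡ true → a ≡ b)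
  where

  contractedAdj : Fin m → Fin m → Bool
  contractedAdj a b = not (a == b) ∧ any (λ u → (E u a ∧ adj G u (centre b)) ∨ (E u b ∧ adj G u (centre a)))

  contracted : Graph
  contracted = record
    { n      = m
    ; adj    = contractedAdj
    ; sym    = λ a b → cong₂ _∧_ (cong not (==-sym a b))
                 (any-cong (λ u → ∨-comm (E u a ∧ adj G u (centre b)) (E u b ∧ adj G u (centre a))))
    ; irrefl = λ a → cong (λ t → not t ∧ _) (==-refl a)
    }

  contractedAdj⁺ : ∀ {a b} u → a ≢ b → E u a ≡ true → adj G u (centre b) ≡ true → contractedAdj a b ≡ true
  contractedAdj⁺ {a} {b} u a≢b Eua adj-u-b = ∧-intro (cong not (==-≢ a≢b))
    (any⁺ (λ u → (E u a ∧ adj G u (centre b)) ∨ (E u b ∧ adj G u (centre a))) u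
          (cong (_∨ (E u b ∧ adj G u (centre a))) (∧-intro Eua adj-u-b)))

  contractedAdj⁻ : ∀ a b → contractedAdj a b ≡ true → ∃ λ u →
    (E u a ≡ true × adj G u (centre b) ≡ true) ⊎ (E u b ≡ true × adj G u (centre a) ≡ true)
  contractedAdj⁻ a b ab with any⁻ (λ u → (E u a ∧ adj G u (centre b)) ∨ (E u b ∧ adj G u (centre a))) (proj₂ (∧-elim ab))
  ... | u , witness with ∨-elim witness
  ... | inj₁ leaf-a = u , inj₁ (∧-elim leaf-a)
  ... | inj₂ leaf-b = u , inj₂ (∧-elim leaf-b)

  centre-inStar : ∀ a → inStar centre E a (centre a) ≡ true
  centre-inStar a = cong (_∨ E (centre a) a) (==-refl (centre a))

  leaf-inStar : ∀ {u} a → E u a ≡ true → inStar centre E a u ≡ true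
  leaf-inStar {u} a Eua = trans (cong ((u == centre a) ∨_) Eua) (∨-zeroʳ _)

  adj-centre : ∀ {u} a → E u a ≡ true → adj G (centre a) u ≡ true
  adj-centre {u} a Eua = trans (adj-sym G (centre a) u) (leaf-adjacent u a Eua)

  module Lift (B : Fin m → Bool) where

    lifted : Fin (n G) → Bool
    lifted v = any (λ a → B a ∧ inStar centre E a v)

    lifted⁺ : ∀ a v → B a ≡ true → inStar centre E a v ≡ true → lifted v ≡ true
    lifted⁺ a v Ba va = any⁺ (λ a → B a ∧ inStar centre E a v) a (∧-intro Ba va)

    lifted⁻ : ∀ v → lifted v ≡ true → ∃ λ a → B a ≡ true × inStar centre E a v ≡ true
    lifted⁻ v lv = let a , Ba,va = any⁻ (λ a → B a ∧ inStar centre E a v) lv in a , ∧-elim Ba,va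

    to-centre : ∀ a v → B a ≡ true → inStar centre E a v ≡ true → WalkIn G lifted v (centre a)
    to-centre a v Ba va with ∨-elim va
    ... | inj₁ v==ca = subst (λ x → WalkIn G lifted x (centre a)) (sym (==⇒≡ v==ca))
                         (here (lifted⁺ a (centre a) Ba (centre-inStar a)))
    ... | inj₂ Eva   = step (lifted⁺ a v Ba va) (leaf-adjacent v a Eva) (here (lifted⁺ a (centre a) Ba (centre-inStar a)))

    from-centre : ∀ a v → B a ≡ true → inStar centre E a v ≡ true → WalkIn G lifted (centre a) v
    from-centre a v Ba va with ∨-elim va
    ... | inj₁ v==ca = subst (WalkIn G lifted (centre a)) (sym (==⇒≡ v==ca))
                         (here (lifted⁺ a (centre a) Ba (centre-inStar a)))
    ... | inj₂ Eva   = step (lifted⁺ a (centre a) Ba (centre-inStar a)) (adj-centre a Eva) (here (lifted⁺ a v Ba va))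

    lift-walk : ∀ {a b} → WalkIn contracted B a b → WalkIn G lifted (centre a) (centre b)
    lift-walk (here Ba) = here (lifted⁺ _ _ Ba (centre-inStar _))
    lift-walk {a} (step {w = c} Ba ac W) with contractedAdj⁻ a c ac
    ... | u , inj₁ (Eua , adj-u-c) =
      step (lifted⁺ a (centre a) Ba (centre-inStar a)) (adj-centre a Eua)
           (step (lifted⁺ a u Ba (leaf-inStar a Eua)) adj-u-c (lift-walk W))
    ... | u , inj₂ (Euc , adj-u-a) =
      step (lifted⁺ a (centre a) Ba (centre-inStar a)) (trans (adj-sym G (centre a) u) adj-u-a)
           (step (lifted⁺ c u (walk-start W) (leaf-inStar c Euc)) (leaf-adjacent u c Euc) (lift-walk W))

    lift-connected : ConnectedSet contracted B → ConnectedSet G lifted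
    lift-connected connected v₁ v₂ lv₁ lv₂ =
      let a₁ , Ba₁ , a₁v₁ = lifted⁻ v₁ lv₁ ; a₂ , Ba₂ , a₂v₂ = lifted⁻ v₂ lv₂ in
      to-centre a₁ v₁ Ba₁ a₁v₁ ++ʷ (lift-walk (connected a₁ a₂ Ba₁ Ba₂) ++ʷ from-centre a₂ v₂ Ba₂ a₂v₂)

  open Lift using (lifted; lifted⁺; lifted⁻; lift-connected)

  contracted-minor : ∀ k → HasCliqueMinor contracted k → HasCliqueMinor G k
  contracted-minor k (B , nonempty , connected , disjoint , touching) =
    (λ i → lifted (B i)) , nonempty′ , (λ i → lift-connected (B i) (connected i)) , disjoint′ , touching′
    where
    nonempty′ : ∀ i → ∃ λ v → lifted (B i) v ≡ true
    nonempty′ i = let a , Bia = nonempty i in centre a , lifted⁺ (B i) a (centre a) Bia (centre-inStar a)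

    disjoint′ : ∀ i j v → i ≢ j → lifted (B i) v ≡ true → lifted (B j) v ≡ false
    disjoint′ i j v i≢j liv = ¬-not λ ljv →
      let a , Bia , av = lifted⁻ (B i) v liv ; b , Bjb , bv = lifted⁻ (B j) v ljv in
      case trans (sym (disjoint i j a i≢j Bia)) (subst (λ c → B j c ≡ true) (sym (stars-disjoint v a b av bv)) Bjb) of λ ()

    touching′ : ∀ i j → i ≢ j → ∃ λ u → ∃ λ v → lifted (B i) u ≡ true × lifted (B j) v ≡ true × adj G u v ≡ true
    touching′ i j i≢j with touching i j i≢j
    ... | a , b , Bia , Bjb , ab with contractedAdj⁻ a b ab
    ... | u , inj₁ (Eua , adj-u-b) =
      u , centre b , lifted⁺ (B i) a u Bia (leaf-inStar a Eua) , lifted⁺ (B j) b (centre b) Bjb (centre-inStar b) , adj-u-b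
    ... | u , inj₂ (Eub , adj-u-a) =
      centre a , u , lifted⁺ (B i) a (centre a) Bia (centre-inStar a) , lifted⁺ (B j) b u Bjb (leaf-inStar b Eub) ,
      trans (adj-sym G (centre a) u) adj-u-a

-- Degrees and biregular bipartite graphs

minDegree≤avgDegree : (G : Graph) {c d : ℕ} → (∀ v → c ≤ degree G v) → AvgDegreeAtMost G d → 0 < n G → c ≤ d
minDegree≤avgDegree G {c} {d} c≤deg avg≤d 0<n = *-cancelʳ-≤ c d (n G) {{>-nonZero 0<n}} (begin
  c * n G                ≡⟨ *-comm c (n G) ⟩
  n G * c                ≡⟨ sum-const (n G) c ⟨
  sum {n G} (λ _ → c)    ≤⟨ sum-mono-≤ c≤deg ⟩
  sum (degree G)         ≡⟨ sumFin≡sum (degree G) ⟨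
  degreeSum G            ≤⟨ avg≤d ⟩
  d * n G                ∎)
  where open ≤-Reasoning

∃-degree≤avgDegree : (G : Graph) {d : ℕ} → AvgDegreeAtMost G d → 0 < n G → ∃ λ v → degree G v ≤ d
∃-degree≤avgDegree G {d} avg≤d 0<n with any? (λ v → degree G v ≤? d)
... | yes small = small
... | no  none  = contradiction avg≤d (<⇒≱ (begin-strict
  d * n G                ≡⟨ *-comm d (n G) ⟩
  n G * d                <⟨ m<n+m (n G * d) 0<n ⟩
  n G + n G * d          ≡⟨ *-suc (n G) d ⟨
  n G * suc d            ≡⟨ sum-const (n G) (suc d) ⟨
  sum {n G} (λ _ → suc d) ≤⟨ sum-mono-≤ (λ v → ≰⇒> (λ deg≤d → none (v , deg≤d))) ⟩
  sum (degree G)         ≡⟨ sumFin≡sum (degree G) ⟨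
  degreeSum G            ∎))
  where open ≤-Reasoning

module _ (G : Graph) (side : SideAssignment G) (bipartite : IsBipartition G side) where

  V₂ : Fin (n G) → Bool
  V₂ v = not (side v)

  ι : Fin (count V₂) → Fin (n G)
  ι = enum V₂

  side-ι : ∀ a → side (ι a) ≡ false
  side-ι a = trans (sym (not-involutive _)) (cong not (enum-member V₂ a))

  adjacent⇒opposite-sides : ∀ u v → adj G u v ≡ true → side u ≡ not (side v)
  adjacent⇒opposite-sides u v uv = ¬-not (bipartite u v uv)

  adj-ι⇒side : ∀ u a → adj G u (ι a) ≡ true → side u ≡ true
  adj-ι⇒side u a uιa = trans (adjacent⇒opposite-sides u (ι a) uιa) (cong not (side-ι a))

  count-adj∘ι : ∀ u → side u ≡ true → count (λ a → adj G u (ι a)) ≡ degree G u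
  count-adj∘ι u su = trans (count∘enum V₂ (adj G u)) (count-cong V₂∧adj≗adj)
    where
    V₂∧adj≗adj : ∀ v → V₂ v ∧ adj G u v ≡ adj G u v
    V₂∧adj≗adj v with adj G u v in uv
    ... | true  = trans (∧-identityʳ (V₂ v))
                    (cong not (trans (adjacent⇒opposite-sides v u (trans (adj-sym G v u) uv)) (cong not su)))
    ... | false = ∧-zeroʳ (V₂ v)

  biregular⇒minDegree : ∀ {c₁ c₂} → IsBiregular G side c₁ c₂ → c₁ ≤ c₂ → ∀ v → c₁ ≤ degree G v
  biregular⇒minDegree (reg₁ , reg₂) c₁≤c₂ v with side v in sv
  ... | true  = ≤-reflexive (sym (reg₁ v sv))
  ... | false = ≤-trans c₁≤c₂ (≤-reflexive (sym (reg₂ v sv)))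

  biregular⇒0<c₁ : ∀ {c₁ c₂} → IsBiregular G side c₁ c₂ → 0 < c₂ → (∃ λ w → side w ≡ false) → 0 < c₁
  biregular⇒0<c₁ (reg₁ , reg₂) 0<c₂ (w , sw) =
    let u , wu = 1≤count⇒member (adj G w) (subst (0 <_) (sym (reg₂ w sw)) 0<c₂)
        su = trans (adjacent⇒opposite-sides u w (trans (adj-sym G u w) wu)) (cong not sw)
    in subst (0 <_) (reg₁ u su) (member⇒1≤count (adj G u) w (trans (adj-sym G u w) wu))

  E₀ : BRel (n G) (count V₂)
  E₀ u a = adj G u (ι a)

  -- Double counting the edges between a set A ⊆ V₂ and its neighbourhood: c₂ |A| ≤ c₁ |N(A)|.
  hall-E₀ : ∀ q {c₁ c₂} → IsBiregular G side c₁ c₂ → 0 < c₁ → q * c₁ ≤ c₂ → Hall q E₀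
  hall-E₀ q {c₁} {c₂} (reg₁ , reg₂) 0<c₁ qc₁≤c₂ A = *-cancelʳ-≤ (q * count A) (count (N A)) c₁ {{>-nonZero 0<c₁}} (begin
    q * count A * c₁                                      ≡⟨ cong (_* c₁) (*-comm q (count A)) ⟩
    count A * q * c₁                                      ≡⟨ *-assoc (count A) q c₁ ⟩
    count A * (q * c₁)                                    ≤⟨ *-monoʳ-≤ (count A) qc₁≤c₂ ⟩
    count A * c₂                                          ≡⟨ cong (_* c₂) (count≡sum A) ⟩
    sum (iverson ∘ A) * c₂                                ≡⟨ *-distribʳ-sum c₂ (iverson ∘ A) ⟩
    sum (λ a → iverson (A a) * c₂)                        ≡⟨ sum-cong-≗ rows ⟨
    sum (λ a → count (λ u → A a ∧ adj G (ι a) u))         ≡⟨ count-comm (λ a u → A a ∧ adj G (ι a) u) ⟩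
    sum (λ u → count (λ a → A a ∧ adj G (ι a) u))         ≤⟨ sum-mono-≤ columns ⟩
    sum (λ u → iverson (N A u) * c₁)                      ≡⟨ *-distribʳ-sum c₁ (iverson ∘ N A) ⟨
    sum (iverson ∘ N A) * c₁                              ≡⟨ cong (_* c₁) (count≡sum (N A)) ⟨
    count (N A) * c₁                                      ∎)
    where
    open ≤-Reasoning
    N : (Fin (count V₂) → Bool) → Fin (n G) → Bool
    N = neighbours E₀

    rows : ∀ a → count (λ u → A a ∧ adj G (ι a) u) ≡ iverson (A a) * c₂
    rows a = trans (count-∧ˡ (A a) (adj G (ι a))) (cong (iverson (A a) *_) (reg₂ (ι a) (side-ι a)))

    columns : ∀ u → count (λ a → A a ∧ adj G (ι a) u) ≤ iverson (N A u) * c₁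
    columns u with N A u in NAu
    ... | true  = let a , _ , uιa = neighbour⁻ E₀ A NAu in begin
      count (λ a → A a ∧ adj G (ι a) u)    ≤⟨ count-mono (λ b Ab,ιbu → trans (adj-sym G u (ι b)) (proj₂ (∧-elim Ab,ιbu))) ⟩
      count (λ a → adj G u (ι a))          ≡⟨ count-adj∘ι u (adj-ι⇒side u a uιa) ⟩
      degree G u                           ≡⟨ reg₁ u (adj-ι⇒side u a uιa) ⟩
      c₁                                   ≡⟨ +-identityʳ c₁ ⟨
      1 * c₁                               ∎
    ... | false = ≤-reflexive (count-none (λ a → A a ∧ adj G (ι a) u) λ a Aa,ιau →
      let Aa , ιau = ∧-elim Aa,ιau in
      case trans (sym (neighbour⁺ E₀ A a Aa (trans (adj-sym G u (ι a)) ιau))) NAu of λ ())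

  same-side⇒¬adj : ∀ u v → side u ≡ side v → adj G u v ≡ false
  same-side⇒¬adj u v su≡sv = ¬-not λ uv → bipartite u v uv su≡sv

  hall⇒binomially-dense-minor : ∀ q {c₁ c₂} → IsBiregular G side c₁ c₂ → LeftTwinFree G side → Hall q E₀ →
    (∃ λ w → side w ≡ false) →
    Σ Graph λ H → (∀ k → HasCliqueMinor H k → HasCliqueMinor G k) × 0 < n H × (∀ a → q ≤ degree H a C pred c₁)
  hall⇒binomially-dense-minor q {c₁} (reg₁ , _) twinFree hallE₀ (w , sw) with hall⇒functional-subrelation q E₀ hallE₀
  ... | F , F⊆E₀ , hallF , functionalF =
    contracted , contracted-minor , member⇒1≤count V₂ w (cong not sw) , λ a → ≤-trans (q≤star a) (star≤binomial a)
    where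
    leaf-side : ∀ {v b} → F v b ≡ true → side v ≡ true
    leaf-side {v} {b} Fvb = adj-ι⇒side v b (F⊆E₀ v b Fvb)

    centre-side : ∀ {v a} → (v == ι a) ≡ true → side v ≡ false
    centre-side {a = a} v==ιa = trans (cong side (==⇒≡ v==ιa)) (side-ι a)

    stars-disjoint : ∀ v a b → inStar ι F a v ≡ true → inStar ι F b v ≡ true → a ≡ b
    stars-disjoint v a b va vb with ∨-elim va | ∨-elim vb
    ... | inj₁ v==ιa | inj₁ v==ιb = enum-injective V₂ (trans (sym (==⇒≡ {i = v} v==ιa)) (==⇒≡ {i = v} v==ιb))
    ... | inj₁ v==ιa | inj₂ Fvb   = case trans (sym (centre-side v==ιa)) (leaf-side Fvb) of λ ()
    ... | inj₂ Fva   | inj₁ v==ιb = case trans (sym (centre-side v==ιb)) (leaf-side Fva) of λ ()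
    ... | inj₂ Fva   | inj₂ Fvb   = functionalF v a b Fva Fvb

    open StarContraction G ι F F⊆E₀ stars-disjoint

    q≤star : ∀ a → q ≤ count (λ u → F u a)
    q≤star a = subst₂ _≤_ (trans (cong (q *_) (count-== a)) (*-identityʳ q))
                          (count-cong (neighbours-== F a)) (hallF (_== a))

    star≤binomial : ∀ a → count (λ u → F u a) ≤ degree contracted a C pred c₁
    star≤binomial a = count-family≤nCk (contractedAdj a) (pred c₁) (λ u → F u a) link link⊆ |link| link-injective
      where
      link : Fin (n G) → Fin (count V₂) → Bool
      link u b = adj G u (ι b) ∧ not (b == a)

      link-away : ∀ u {b} → b ≢ a → link u b ≡ adj G u (ι b)
      link-away u b≢a = trans (cong (λ t → adj G u _ ∧ not t) (==-≢ b≢a)) (∧-identityʳ _)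

      link⊆ : ∀ u → F u a ≡ true → link u ⊆ contractedAdj a
      link⊆ u Fua b link-ub = let uιb , b≠a = ∧-elim link-ub in
        contractedAdj⁺ u (λ a≡b → case trans (sym b≠a) (cong not (trans (cong (b ==_) a≡b) (==-refl b))) of λ ())
          Fua uιb

      |link| : ∀ u → F u a ≡ true → count (link u) ≡ pred c₁
      |link| u Fua = cong pred (begin-equality
        suc (count (link u))              ≡⟨ count-remove (λ b → adj G u (ι b)) a (F⊆E₀ u a Fua) ⟨
        count (λ b → adj G u (ι b))       ≡⟨ count-adj∘ι u (leaf-side Fua) ⟩
        degree G u                        ≡⟨ reg₁ u (leaf-side Fua) ⟩
        c₁                                ∎)
        where open ≤-Reasoning

      link-injective : ∀ u v → F u a ≡ true → F v a ≡ true → (∀ b → link u b ≡ link v b) → u ≡ v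
      link-injective u v Fua Fva same-link = decidable-stable (u ≟ v) λ u≢v →
        twinFree u v (leaf-side Fua) (leaf-side Fva) u≢v same-neighbours
        where
        same-neighbours : ∀ x → adj G u x ≡ adj G v x
        same-neighbours x with side x in sx
        ... | true  = trans (same-side⇒¬adj u x (trans (leaf-side Fua) (sym sx)))
                            (sym (same-side⇒¬adj v x (trans (leaf-side Fva) (sym sx))))
        ... | false with enum-surjective V₂ x (cong not sx)
        ... | b , refl with toSum (b ≟ a)
        ... | inj₁ refl = trans (F⊆E₀ u a Fua) (sym (F⊆E₀ v a Fva))
        ... | inj₂ b≢a  = trans (sym (link-away u b≢a)) (trans (same-link b) (link-away v b≢a))

lemma4p2 : (α : ℕ → ℕ) → KostochkaBound α →
    ∀ (h : ℕ) → 1 ≤ h →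
    ∀ (G : Graph) (side : SideAssignment G) (c₁ c₂ : ℕ) →
    IsBipartition G side → (∃ λ v → side v ≡ false) →
    IsBiregular G side c₁ c₂ → c₁ ≤ c₂ → LeftTwinFree G side →
    ¬ HasCliqueMinor G (suc h) →
    c₂ ≤ α h * ((α h C ⌈ α h /2⌉) + 1)
lemma4p2 α kostochka h 1≤h G side c₁ c₂ bipartite V₂≠∅ biregular c₁≤c₂ twinFree noMinor
  with c₂ ≤? α h * (α h C ⌈ α h /2⌉ + 1)
... | yes c₂≤dq = c₂≤dq
... | no  c₂≰dq =
  let H , H≼G , 0<|H| , q≤binomial = hall⇒binomially-dense-minor G side bipartite q biregular twinFree
                                       (hall-E₀ G side bipartite q biregular 0<c₁ qc₁≤c₂) V₂≠∅
      a , deg≤d = ∃-degree≤avgDegree H (kostochka h 1≤h H (noMinor ∘ H≼G (suc h))) 0<|H|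
  in contradiction (begin
    q                       ≤⟨ q≤binomial a ⟩
    degree H a C pred c₁    ≤⟨ nCk-monoˡ (pred c₁) deg≤d ⟩
    d C pred c₁             ≤⟨ nCk≤nC⌈n/2⌉ d (pred c₁) ⟩
    d C ⌈ d /2⌉             ∎) (m+1+n≰m (d C ⌈ d /2⌉))
  where
  open ≤-Reasoning
  d q : ℕ
  d = α h
  q = d C ⌈ d /2⌉ + 1

  c₁≤d : c₁ ≤ d
  c₁≤d = minDegree≤avgDegree G (biregular⇒minDegree G side bipartite biregular c₁≤c₂)
    (kostochka h 1≤h G noMinor) (>-nonZero⁻¹ (n G) {{Fin.nonZeroIndex (proj₁ V₂≠∅)}})

  0<c₁ : 0 < c₁
  0<c₁ = biregular⇒0<c₁ G side bipartite biregular (≤-trans (s≤s z≤n) (≰⇒> c₂≰dq)) V₂≠∅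

  qc₁≤c₂ : q * c₁ ≤ c₂
  qc₁≤c₂ = begin
    q * c₁     ≤⟨ *-monoʳ-≤ q c₁≤d ⟩
    q * d      ≡⟨ *-comm q d ⟩
    d * q      <⟨ ≰⇒> c₂≰dq ⟩
    c₂         ∎
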